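{- Let $B=B'(p)$ be an integral base-polyhedron on ground-set $S$, with canonical chain $\{C_1,\dots,C_q\}$, canonical partition $\{S_1,\dots,S_q\}$ and essential value-sequence $\beta_1>\dots>\beta_q$. Then an element $m\in B\cap\mathbb{Z}^S$ is decreasingly minimal in $B\cap\mathbb{Z}^S$ if and only if $\widetilde m(C_i)=p(C_i)$ for each $i=1,\dots,q$ and $\beta_i-1\le m(s)\le\beta_i$ for each $s\in S_i$, $i=1,\dots,q$.
   Context: $S$ is a finite non-empty set; $p$ is a set-function on subsets of $S$ with values in $\mathbb{Z}\cup\{ -\infty\}$, $p(\emptyset)=0$, $p(S)$ finite, and supermodular: $p(X)+p(Y)\le p(X\cap Y)+p(X\cup Y)$ whenever $p(X),p(Y)$ are finite. $B'(p)=\{x\in\mathbb{R}^S:\widetilde x(S)=p(S),\ \widetilde x(Z)\ge p(Z)\ \forall Z\subset S\}$, $\widetilde x(Z)=\sum_{s\in Z}x(s)$. Canonical construction: $C_0=\emptyset$; for $j=1,2,\dots$ while $C_{j-1}\ne S$, let $\beta_j:=\max\{\lceil (p(X\cup C_{j-1})-p(C_{j-1}))/|X|\rceil:\emptyset\neq X\subseteq S-C_{j-1}\}$, $h_j(X):=p(X\cup C_{j-1})-p(C_{j-1})-(\beta_j-1)|X|$ for $X\subseteq S-C_{j-1}$, $S_j$ the intersection of all maximizers of $h_j$ (non-empty), $C_j:=C_{j-1}\cup S_j$; $q$ is the index with $C_q=S$. With $x{\downarrow}$ the decreasing rearrangement of $x$, $m$ is decreasingly minimal in $B\cap\mathbb{Z}^S$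 if for every $y$ in it, $m{\downarrow}=y{\downarrow}$ or $m{\downarrow}(j)<y{\downarrow}(j)$ at the first index where they differ. -}

module Defs where

open import Data.Nat as ℕ using (ℕ; zero; suc)
open import Data.Integer as ℤ using (ℤ; +_; _+_; _-_; _*_; -_; _≤_; _<_; _/ℕ_)
open import Data.Integer.Properties using (≤-decTotalOrder)
open import Data.Fin using (Fin; zero; suc; inject₁; fromℕ)
open import Data.Fin.Subset using (Subset; _∈_; _⊆_; ⊤; ⊥; _∪_; _∩_; ∁; ∣_∣; Nonempty)
open import Data.Fin.Subset using (inside; outside)
open import Data.Vec using (_∷_)
open import Data.List using (List; []; reverse) renaming (_∷_ to _∷ₗ_)
open import Data.Vec.Functional using (toList)
open import Data.Sum using (_⊎_)
open import Data.Product using (Σ; ∃; _×_; _,_)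
open import Relation.Nullary using (¬_; yes; no)
open import Relation.Binary.PropositionalEquality using (_≡_; _≢_)
open import Function.Bundles using (_⇔_)
import Data.List.Sort as Sort

data ℤ∞ : Set where
  -∞  : ℤ∞
  fin : ℤ → ℤ∞

data _≤∞_ : ℤ∞ → ℤ∞ → Set where
  -∞≤    : ∀ {y} → -∞ ≤∞ y
  fin≤fin : ∀ {a b} → a ≤ b → fin a ≤∞ fin b

-- Ground set S = Fin n, subsets of S = Subset n

sumOn : ∀ {n} → (Fin n → ℤ) → Subset n → ℤ
sumOn {zero}  x Z = + 0
sumOn {suc n} x (inside  ∷ Z) = x zero + sumOn (λ i → x (suc i)) Z
sumOn {suc n} x (outside ∷ Z) = sumOn (λ i → x (suc i)) Z

Supermodular : ∀ {n} → (Subset n → ℤ∞) → Set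
Supermodular {n} p = ∀ (X Y : Subset n) (a b : ℤ) → p X ≡ fin a → p Y ≡ fin b →
  Σ ℤ λ c → Σ ℤ λ d → p (X ∩ Y) ≡ fin c × p (X ∪ Y) ≡ fin d × a + b ≤ c + d

record IsSupermodularFn {n} (p : Subset n → ℤ∞) : Set where
  field
    p-empty : p ⊥ ≡ fin (+ 0)
    p-S-fin : Σ ℤ λ c → p ⊤ ≡ fin c
    supermod : Supermodular p

InB : ∀ {n} → (Subset n → ℤ∞) → (Fin n → ℤ) → Set
InB {n} p x = (p ⊤ ≡ fin (sumOn x ⊤)) × (∀ (Z : Subset n) → Z ≢ ⊤ → p Z ≤∞ fin (sumOn x Z))

open Sort ≤-decTotalOrder using (sort)

_↓ : ∀ {n} → (Fin n → ℤ) → List ℤ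
x ↓ = reverse (sort (toList x))

data LexLt : List ℤ → List ℤ → Set where
  here  : ∀ {a b as bs} → a < b → LexLt (a ∷ₗ as) (b ∷ₗ bs)
  there : ∀ {a as bs} → LexLt as bs → LexLt (a ∷ₗ as) (a ∷ₗ bs)

DecMin : ∀ {n} → (Subset n → ℤ∞) → (Fin n → ℤ) → Set
DecMin p m = InB p m × (∀ y → InB p y → (m ↓ ≡ y ↓) ⊎ LexLt (m ↓) (y ↓))

-- ⌈ a / k ⌉ for k ≥ 1 (k = 0 never used)
⌈_/_⌉ : ℤ → ℕ → ℤ
⌈ a / zero ⌉  = + 0
⌈ a / suc k ⌉ = - ((- a) /ℕ suc k)

hfun : ∀ {n} → (Subset n → ℤ∞) → Subset n → ℤ → ℤ → Subset n → ℤ∞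
hfun p C d β X with p (X ∪ C)
... | -∞    = -∞
... | fin a = fin (a - d - (β - + 1) * + ∣ X ∣)

IsMaximizer : ∀ {n} → (Subset n → ℤ∞) → Subset n → ℤ → ℤ → Subset n → Set
IsMaximizer p C d β X = X ⊆ ∁ C ×
  Σ ℤ λ v → hfun p C d β X ≡ fin v × (∀ Y → Y ⊆ ∁ C → hfun p C d β Y ≤∞ fin v)

-- One step j, given C = C_{j-1} with p(C) = fin d, value β = β_j and part Sj = S_j.
record CanonicalStep {n} (p : Subset n → ℤ∞) (C : Subset n) (β : ℤ) (Sj : Subset n) : Set where
  field
    d      : ℤ
    p-C    : p C ≡ fin d
    β-attained : Σ (Subset n) λ X → Nonempty X × X ⊆ ∁ C ×
                   Σ ℤ λ a → p (X ∪ C) ≡ fin a × ⌈ a - d / ∣ X ∣ ⌉ ≡ β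
    β-upper    : ∀ (X : Subset n) → Nonempty X → X ⊆ ∁ C → ∀ a → p (X ∪ C) ≡ fin a →
                   ⌈ a - d / ∣ X ∣ ⌉ ≤ β
    Sj-def : ∀ (s : Fin n) → (s ∈ Sj) ⇔ (∀ X → IsMaximizer p C d β X → s ∈ X)

-- The canonical chain C_0 = ∅ ⊂ C_1 ⊂ ... ⊂ C_q = S (index i : Fin (suc q) is C_i),
-- essential values β (β i is β_{i+1}) and canonical partition Sp (Sp i is S_{i+1}).
record IsCanonical {n} (p : Subset n → ℤ∞) (q : ℕ)
    (β : Fin q → ℤ) (C : Fin (suc q) → Subset n) (Sp : Fin q → Subset n) : Set where
  field
    C-zero : C zero ≡ ⊥
    C-last : C (fromℕ q) ≡ ⊤
    C-proceed : ∀ (j : Fin q) → C (inject₁ j) ≢ ⊤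
    step : ∀ (j : Fin q) → CanonicalStep p (C (inject₁ j)) (β j) (Sp j)
    C-next : ∀ (j : Fin q) → C (suc j) ≡ C (inject₁ j) ∪ Sp j

{-# OPTIONS --safe #-}
module Submission where

-- A unit transfer from s to t with y t + 1 < y s stays in B exactly when no y-tight set contains s
-- but not t, and it strictly decreases y↓ (and Σ y²).  So a decreasingly minimal m admits no such
-- transfer, and every y ∈ B descends by such transfers to an element admitting none.
-- For an element y without improving transfers the y-tight sets form a lattice, and along the
-- canonical chain C_{j-1} ∪ S_j is the smallest tight set containing C_{j-1} and every s ∉ C_{j-1}
-- with y s = β_j: values outside C_{j-1} are at most β_j, those on S_j at least β_j - 1, and S_j is
-- recovered as the intersection of the maximizers of h_j.  Finally these conditions determine y↓:
-- on S_j the values lie in {β_j - 1, β_j} and sum to p(C_j) - p(C_{j-1}).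

open import Defs

open import Data.Bool using (if_then_else_)
import Data.Bool.Properties as BoolP
open import Data.Fin using (Fin; zero; suc; inject₁; fromℕ)
open import Data.Fin.Induction using (<-weakInduction)
import Data.Fin.Properties as FinP
open import Data.Fin.Subset using (Subset; _∈_; _∉_; _⊆_; ⊤; ⊥; _∪_; _∩_; _─_; ∁; ∣_∣; inside; outside)
open import Data.Fin.Subset.Properties
  using (_∈?_; _⊆?_; anySubset?; ∈⊤; ∉⊥; ⊆⊤; ⊆-antisym; drop-∷-⊆; Empty-unique; p∩q⊆p; p∩q⊆q; p⊆p∪q;
         q⊆p∪q; x∈p∩q⁺; x∈p∩q⁻; x∈p∪q⁻; x∈∁p⇒x∉p; x∉p⇒x∈∁p; p─q⊆p; x∈p∧x∉q⇒x∈p─q; x∈p⇒∣p-x∣<∣p∣;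
         ∪-distribʳ-∩; ∪-inverseˡ; ∩-identityʳ; ∪-comm)
open import Data.Integer as ℤ using (ℤ; +_; _+_; _-_; _*_; -_; _≤_; _<_; 0ℤ; 1ℤ)
import Data.Integer.DivMod as ℤDM
import Data.Integer.Properties as ℤP
open import Data.Integer.Tactic.RingSolver using (solve-∀)
open import Data.List using (List; []; _∷_; reverse; length)
import Data.List.Properties as ListP
open import Data.List.Relation.Binary.Permutation.Propositional as ↭ using (_↭_; ↭-sym)
open import Data.List.Relation.Binary.Permutation.Propositional.Properties using (All-resp-↭; ↭-reverse; ↭-length)
open import Data.List.Relation.Unary.All as All using (All; []; _∷_)
open import Data.List.Relation.Unary.AllPairs as AllPairs using (AllPairs; []; _∷_)
import Data.List.Relation.Unary.AllPairs.Properties as AllPairsP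
open import Data.List.Relation.Unary.Linked.Properties using (Linked⇒AllPairs)
import Data.List.Sort as Sort
open import Data.Nat as ℕ using (ℕ; zero; suc)
open import Data.Nat.Induction using (<-wellFounded)
import Data.Nat.Properties as ℕP
open import Data.Product using (_×_; _,_; ∃; ∃₂; proj₁; proj₂; uncurry)
open import Data.Sum using (_⊎_; inj₁; inj₂; [_,_])
open import Data.Vec using ([]; _∷_; here; there)
open import Data.Vec.Functional using (toList)
import Data.Vec.Properties as VecP
open import Function using (_∘_)
open import Function.Bundles using (_⇔_; mk⇔; Equivalence)
open import Induction.WellFounded using (Acc; acc)
open import Relation.Binary.Definitions using (tri<; tri≈; tri>)
open import Relation.Binary.PropositionalEquality hiding ([_])
open import Relation.Nullary using (Dec; yes; no; does; ¬_; contradiction)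
open import Relation.Nullary.Decidable using (_×-dec_; _→-dec_; ¬?; decidable-stable)
open import Relation.Unary using (Decidable)

open import Algebra.Properties.AbelianGroup ℤP.+-0-abelianGroup using ()
  renaming (∙-cancelˡ to +-cancelˡ-≡; ∙-cancelʳ to +-cancelʳ-≡)
open import Algebra.Properties.CommutativeSemigroup ℤP.+-commutativeSemigroup using ()
  renaming (interchange to +-interchange; x∙yz≈y∙xz to x+[y+z]≡y+[x+z])
open Sort ℤP.≤-decTotalOrder using (sort; sort-↭; sort-↗)

0<1 : 0ℤ < 1ℤ
0<1 = ℤ.+<+ (ℕ.s≤s ℕ.z≤n)

≤-+-nonneg : ∀ a {r} → 0ℤ ≤ r → a ≤ a + r
≤-+-nonneg a {r} r≥0 = subst (_≤ a + r) (ℤP.+-identityʳ a) (ℤP.+-monoʳ-≤ a r≥0)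

<-+-pos : ∀ a {r} → 0ℤ < r → a < a + r
<-+-pos a {r} r>0 = subst (_< a + r) (ℤP.+-identityʳ a) (ℤP.+-monoʳ-< a r>0)

+-minus-cancel : ∀ x c → x + c - c ≡ x
+-minus-cancel = solve-∀

minus-+-cancel : ∀ x c → x - c + c ≡ x
minus-+-cancel = solve-∀

+-cancelʳ-≤ : ∀ {a b} c → a + c ≤ b + c → a ≤ b
+-cancelʳ-≤ {a} {b} c le = subst₂ _≤_ (+-minus-cancel a c) (+-minus-cancel b c) (ℤP.+-monoˡ-≤ (- c) le)

+-cancelʳ-< : ∀ {a b} c → a + c < b + c → a < b
+-cancelʳ-< {a} {b} c lt = subst₂ _<_ (+-minus-cancel a c) (+-minus-cancel b c) (ℤP.+-monoˡ-< (- c) lt)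

+-cancelˡ-≤ : ∀ a {b c} → a + b ≤ a + c → b ≤ c
+-cancelˡ-≤ a {b} {c} le = +-cancelʳ-≤ a (subst₂ _≤_ (ℤP.+-comm a b) (ℤP.+-comm a c) le)

+-cancelˡ-< : ∀ a {b c} → a + b < a + c → b < c
+-cancelˡ-< a {b} {c} lt = +-cancelʳ-< a (subst₂ _<_ (ℤP.+-comm a b) (ℤP.+-comm a c) lt)

squeeze : ∀ {a b x z} → a ≤ x → b ≤ z → x + z ≤ a + b → a ≡ x × b ≡ z
squeeze {a} {b} {x} {z} a≤x b≤z x+z≤a+b =
  ℤP.≤-antisym a≤x (+-cancelʳ-≤ z (ℤP.≤-trans x+z≤a+b (ℤP.+-monoʳ-≤ a b≤z))) ,
  ℤP.≤-antisym b≤z (+-cancelˡ-≤ x (ℤP.≤-trans x+z≤a+b (ℤP.+-monoˡ-≤ b a≤x)))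

balance-≤ : ∀ {a b u v} → a + u ≡ b + v → v ≤ u → a ≤ b
balance-≤ {a} eq v≤u = +-cancelʳ-≤ _ (ℤP.≤-trans (ℤP.+-monoʳ-≤ a v≤u) (ℤP.≤-reflexive eq))

balance-< : ∀ {a b u v} → a + u ≡ b + v → v < u → a < b
balance-< {a} eq v<u = +-cancelʳ-< _ (ℤP.<-≤-trans (ℤP.+-monoʳ-< a v<u) (ℤP.≤-reflexive eq))

<⇒0<- : ∀ {a b} → a < b → 0ℤ < b - a
<⇒0<- {a} {b} a<b = +-cancelʳ-< a (subst₂ _<_ (sym (ℤP.+-identityˡ a)) (sym (minus-+-cancel b a)) a<b)

<+1⇒≤ : ∀ {a b} → a < b + 1ℤ → a ≤ b
<+1⇒≤ {a} {b} a<b+1 = +-cancelʳ-≤ 1ℤ (subst (_≤ b + 1ℤ) (ℤP.+-comm 1ℤ a) (ℤP.i<j⇒suc[i]≤j a<b+1))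

<⇒≤-1 : ∀ {a b} → a < b → a ≤ b - 1ℤ
<⇒≤-1 {a} {b} a<b = <+1⇒≤ (subst (a <_) (sym (minus-+-cancel b 1ℤ)) a<b)

<-1⇒+1< : ∀ {a b} → a < b - 1ℤ → a + 1ℤ < b
<-1⇒+1< {a} {b} a<b-1 = subst (a + 1ℤ <_) (minus-+-cancel b 1ℤ) (ℤP.+-monoˡ-< 1ℤ a<b-1)

<+1 : ∀ a → a < a + 1ℤ
<+1 a = <-+-pos a 0<1

-1< : ∀ a → a - 1ℤ < a
-1< a = subst (a - 1ℤ <_) (minus-+-cancel a 1ℤ) (<+1 (a - 1ℤ))

∣∣-mono-< : ∀ {a b} → 0ℤ ≤ a → a < b → ℤ.∣ a ∣ ℕ.< ℤ.∣ b ∣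
∣∣-mono-< (ℤ.+≤+ _) (ℤ.+<+ a<b) = a<b

⌈/⌉≤⇒≤* : ∀ a k b → 0 ℕ.< k → ⌈ a / k ⌉ ≤ b → a ≤ b * + k
⌈/⌉≤⇒≤* a (suc k) b _ ⌈a/k⌉≤b = ℤP.neg-cancel-≤ (begin
  - (b * K)             ≡⟨ ℤP.neg-distribˡ-* b K ⟩
  - b * K               ≤⟨ ℤP.*-monoʳ-≤-nonNeg K -b≤q ⟩
  q * K                 ≤⟨ ℤP.i≤j+i (q * K) (+ r) ⟩
  + r + q * K           ≡⟨ ℤDM.a≡a%ℕn+[a/ℕn]*n (- a) (suc k) ⟨
  - a                   ∎)
  where
  open ℤP.≤-Reasoning
  K = + suc k
  q = (- a) ℤ./ℕ suc k
  r = (- a) ℤ.%ℕ suc k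
  -b≤q : - b ≤ q
  -b≤q = subst (- b ≤_) (ℤP.neg-involutive q) (ℤP.neg-mono-≤ ⌈a/k⌉≤b)

sumOn-⊥ : ∀ {n} (f : Fin n → ℤ) → sumOn f ⊥ ≡ 0ℤ
sumOn-⊥ {zero} f = refl
sumOn-⊥ {suc n} f = sumOn-⊥ (f ∘ suc)

sumOn-cong : ∀ {n} {f g : Fin n → ℤ} (Z : Subset n) →
  (∀ {s} → s ∈ Z → f s ≡ g s) → sumOn f Z ≡ sumOn g Z
sumOn-cong [] f≡g = refl
sumOn-cong (inside ∷ Z) f≡g = cong₂ _+_ (f≡g here) (sumOn-cong Z (f≡g ∘ there))
sumOn-cong (outside ∷ Z) f≡g = sumOn-cong Z (f≡g ∘ there)

sumOn-mono-≤ : ∀ {n} {f g : Fin n → ℤ} (Z : Subset n) →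
  (∀ {s} → s ∈ Z → f s ≤ g s) → sumOn f Z ≤ sumOn g Z
sumOn-mono-≤ [] f≤g = ℤP.≤-refl
sumOn-mono-≤ (inside ∷ Z) f≤g = ℤP.+-mono-≤ (f≤g here) (sumOn-mono-≤ Z (f≤g ∘ there))
sumOn-mono-≤ (outside ∷ Z) f≤g = sumOn-mono-≤ Z (f≤g ∘ there)

sumOn-mono-< : ∀ {n} {f g : Fin n → ℤ} (Z : Subset n) →
  (∀ {s} → s ∈ Z → f s ≤ g s) → ∀ {t} → t ∈ Z → f t < g t → sumOn f Z < sumOn g Z
sumOn-mono-< (inside ∷ Z) f≤g here ft<gt = ℤP.+-mono-<-≤ ft<gt (sumOn-mono-≤ Z (f≤g ∘ there))
sumOn-mono-< (inside ∷ Z) f≤g (there t∈Z) ft<gt =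
  ℤP.+-mono-≤-< (f≤g here) (sumOn-mono-< Z (f≤g ∘ there) t∈Z ft<gt)
sumOn-mono-< (outside ∷ Z) f≤g (there t∈Z) ft<gt = sumOn-mono-< Z (f≤g ∘ there) t∈Z ft<gt

sumOn-+ : ∀ {n} (f g : Fin n → ℤ) (Z : Subset n) →
  sumOn (λ s → f s + g s) Z ≡ sumOn f Z + sumOn g Z
sumOn-+ f g [] = refl
sumOn-+ f g (inside ∷ Z) = begin
  f zero + g zero + sumOn (λ s → f (suc s) + g (suc s)) Z
    ≡⟨ cong (_+_ (f zero + g zero)) (sumOn-+ (f ∘ suc) (g ∘ suc) Z) ⟩
  f zero + g zero + (sumOn (f ∘ suc) Z + sumOn (g ∘ suc) Z)
    ≡⟨ +-interchange (f zero) (g zero) _ _ ⟩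
  f zero + sumOn (f ∘ suc) Z + (g zero + sumOn (g ∘ suc) Z) ∎
  where open ≡-Reasoning
sumOn-+ f g (outside ∷ Z) = sumOn-+ (f ∘ suc) (g ∘ suc) Z

sumOn-const : ∀ {n} (c : ℤ) (Z : Subset n) → sumOn (λ _ → c) Z ≡ c * + ∣ Z ∣
sumOn-const c [] = sym (ℤP.*-zeroʳ c)
sumOn-const c (inside ∷ Z) = trans (cong (_+_ c) (sumOn-const c Z)) (sym (ℤP.*-suc c (+ ∣ Z ∣)))
sumOn-const c (outside ∷ Z) = sumOn-const c Z

sumOn-minus-const : ∀ {n} (f : Fin n → ℤ) (c : ℤ) (Z : Subset n) →
  sumOn (λ s → f s - c) Z ≡ sumOn f Z - c * + ∣ Z ∣
sumOn-minus-const f c [] = sym (cong (_-_ 0ℤ) (ℤP.*-zeroʳ c))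
sumOn-minus-const f c (inside ∷ Z) =
  trans (cong (_+_ (f zero - c)) (sumOn-minus-const (f ∘ suc) c Z)) (regroup (f zero) _ c (+ ∣ Z ∣))
  where
  regroup : ∀ a b c k → a - c + (b - c * k) ≡ a + b - c * (+ 1 + k)
  regroup = solve-∀
sumOn-minus-const f c (outside ∷ Z) = sumOn-minus-const (f ∘ suc) c Z

sumOn-∪-∩ : ∀ {n} (f : Fin n → ℤ) (A B : Subset n) →
  sumOn f (A ∪ B) + sumOn f (A ∩ B) ≡ sumOn f A + sumOn f B
sumOn-∪-∩ f [] [] = refl
sumOn-∪-∩ f (inside ∷ A) (inside ∷ B) = begin
  f zero + sumOn (f ∘ suc) (A ∪ B) + (f zero + sumOn (f ∘ suc) (A ∩ B))
    ≡⟨ +-interchange (f zero) _ (f zero) _ ⟩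
  f zero + f zero + (sumOn (f ∘ suc) (A ∪ B) + sumOn (f ∘ suc) (A ∩ B))
    ≡⟨ cong (_+_ (f zero + f zero)) (sumOn-∪-∩ (f ∘ suc) A B) ⟩
  f zero + f zero + (sumOn (f ∘ suc) A + sumOn (f ∘ suc) B)
    ≡⟨ +-interchange (f zero) (f zero) _ _ ⟩
  f zero + sumOn (f ∘ suc) A + (f zero + sumOn (f ∘ suc) B) ∎
  where open ≡-Reasoning
sumOn-∪-∩ f (inside ∷ A) (outside ∷ B) = begin
  f zero + sumOn (f ∘ suc) (A ∪ B) + sumOn (f ∘ suc) (A ∩ B)
    ≡⟨ ℤP.+-assoc (f zero) _ _ ⟩
  f zero + (sumOn (f ∘ suc) (A ∪ B) + sumOn (f ∘ suc) (A ∩ B))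
    ≡⟨ cong (_+_ (f zero)) (sumOn-∪-∩ (f ∘ suc) A B) ⟩
  f zero + (sumOn (f ∘ suc) A + sumOn (f ∘ suc) B)
    ≡⟨ ℤP.+-assoc (f zero) _ _ ⟨
  f zero + sumOn (f ∘ suc) A + sumOn (f ∘ suc) B ∎
  where open ≡-Reasoning
sumOn-∪-∩ f (outside ∷ A) (inside ∷ B) = begin
  f zero + sumOn (f ∘ suc) (A ∪ B) + sumOn (f ∘ suc) (A ∩ B)
    ≡⟨ ℤP.+-assoc (f zero) _ _ ⟩
  f zero + (sumOn (f ∘ suc) (A ∪ B) + sumOn (f ∘ suc) (A ∩ B))
    ≡⟨ cong (_+_ (f zero)) (sumOn-∪-∩ (f ∘ suc) A B) ⟩
  f zero + (sumOn (f ∘ suc) A + sumOn (f ∘ suc) B)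
    ≡⟨ x+[y+z]≡y+[x+z] (f zero) (sumOn (f ∘ suc) A) _ ⟩
  sumOn (f ∘ suc) A + (f zero + sumOn (f ∘ suc) B) ∎
  where open ≡-Reasoning
sumOn-∪-∩ f (outside ∷ A) (outside ∷ B) = sumOn-∪-∩ (f ∘ suc) A B

sumOn-∪-disjoint : ∀ {n} (f : Fin n → ℤ) (A B : Subset n) → (∀ {s} → s ∈ A → s ∉ B) →
  sumOn f (A ∪ B) ≡ sumOn f A + sumOn f B
sumOn-∪-disjoint f A B disjoint = begin
  sumOn f (A ∪ B)                     ≡⟨ ℤP.+-identityʳ _ ⟨
  sumOn f (A ∪ B) + 0ℤ                ≡⟨ cong (_+_ (sumOn f (A ∪ B))) A∩B-sum ⟨
  sumOn f (A ∪ B) + sumOn f (A ∩ B)   ≡⟨ sumOn-∪-∩ f A B ⟩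
  sumOn f A + sumOn f B               ∎
  where
  open ≡-Reasoning
  A∩B-sum : sumOn f (A ∩ B) ≡ 0ℤ
  A∩B-sum = trans (cong (sumOn f) (Empty-unique λ (_ , s∈A∩B) → uncurry disjoint (x∈p∩q⁻ A B s∈A∩B)))
                  (sumOn-⊥ f)

sumOn-⊆-split : ∀ {n} (f : Fin n → ℤ) {X Y : Subset n} → X ⊆ Y →
  sumOn f Y ≡ sumOn f X + sumOn f (Y ─ X)
sumOn-⊆-split f {[]} {[]} X⊆Y = refl
sumOn-⊆-split f {inside ∷ X} {inside ∷ Y} X⊆Y =
  trans (cong (_+_ (f zero)) (sumOn-⊆-split (f ∘ suc) (drop-∷-⊆ X⊆Y))) (sym (ℤP.+-assoc (f zero) _ _))
sumOn-⊆-split f {inside ∷ X} {outside ∷ Y} X⊆Y = contradiction (X⊆Y here) λ ()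
sumOn-⊆-split f {outside ∷ X} {inside ∷ Y} X⊆Y = begin
  f zero + sumOn (f ∘ suc) Y
    ≡⟨ cong (_+_ (f zero)) (sumOn-⊆-split (f ∘ suc) (drop-∷-⊆ X⊆Y)) ⟩
  f zero + (sumOn (f ∘ suc) X + sumOn (f ∘ suc) (Y ─ X))
    ≡⟨ x+[y+z]≡y+[x+z] (f zero) (sumOn (f ∘ suc) X) _ ⟩
  sumOn (f ∘ suc) X + (f zero + sumOn (f ∘ suc) (Y ─ X)) ∎
  where open ≡-Reasoning
sumOn-⊆-split f {outside ∷ X} {outside ∷ Y} X⊆Y = sumOn-⊆-split (f ∘ suc) (drop-∷-⊆ X⊆Y)

∈─⇒∉ : ∀ {n} {s : Fin n} (Y X : Subset n) → s ∈ Y ─ X → s ∉ X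
∈─⇒∉ (inside ∷ Y) (outside ∷ X) here = λ ()
∈─⇒∉ (_ ∷ Y) (_ ∷ X) (there s∈Y─X) (there s∈X) = ∈─⇒∉ Y X s∈Y─X s∈X

sumOn-zeros : ∀ {n} (Z : Subset n) → sumOn (λ _ → 0ℤ) Z ≡ 0ℤ
sumOn-zeros Z = trans (sumOn-const 0ℤ Z) (ℤP.*-zeroˡ (+ ∣ Z ∣))

sumOn-nonneg : ∀ {n} {f : Fin n → ℤ} (Z : Subset n) → (∀ {s} → s ∈ Z → 0ℤ ≤ f s) → 0ℤ ≤ sumOn f Z
sumOn-nonneg {f = f} Z f≥0 = subst (_≤ sumOn f Z) (sumOn-zeros Z) (sumOn-mono-≤ Z f≥0)

sumOn-pos : ∀ {n} {f : Fin n → ℤ} (Z : Subset n) → (∀ {s} → s ∈ Z → 0ℤ ≤ f s) →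
  ∀ {t} → t ∈ Z → 0ℤ < f t → 0ℤ < sumOn f Z
sumOn-pos {f = f} Z f≥0 t∈Z ft>0 = subst (_< sumOn f Z) (sumOn-zeros Z) (sumOn-mono-< Z f≥0 t∈Z ft>0)

sumOn-⊆-≤ : ∀ {n} {f : Fin n → ℤ} {X Y : Subset n} → X ⊆ Y →
  (∀ {s} → s ∈ Y → 0ℤ ≤ f s) → sumOn f X ≤ sumOn f Y
sumOn-⊆-≤ {f = f} {X} {Y} X⊆Y f≥0 =
  subst (sumOn f X ≤_) (sym (sumOn-⊆-split f X⊆Y))
    (≤-+-nonneg (sumOn f X) (sumOn-nonneg (Y ─ X) (f≥0 ∘ p─q⊆p Y X)))

sumOn-⊆-< : ∀ {n} {f : Fin n → ℤ} {X Y : Subset n} → X ⊆ Y →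
  (∀ {s} → s ∈ Y → 0ℤ ≤ f s) → ∀ {t} → t ∈ Y → t ∉ X → 0ℤ < f t → sumOn f X < sumOn f Y
sumOn-⊆-< {f = f} {X} {Y} X⊆Y f≥0 t∈Y t∉X ft>0 =
  subst (sumOn f X <_) (sym (sumOn-⊆-split f X⊆Y))
    (<-+-pos (sumOn f X) (sumOn-pos (Y ─ X) (f≥0 ∘ p─q⊆p Y X) (x∈p∧x∉q⇒x∈p─q t∈Y t∉X) ft>0))

sumOn-⊆-≡ : ∀ {n} {f : Fin n → ℤ} {X Y : Subset n} → X ⊆ Y →
  (∀ {s} → s ∈ Y → s ∉ X → f s ≡ 0ℤ) → sumOn f X ≡ sumOn f Y
sumOn-⊆-≡ {f = f} {X} {Y} X⊆Y f≡0 = begin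
  sumOn f X                      ≡⟨ ℤP.+-identityʳ _ ⟨
  sumOn f X + 0ℤ                 ≡⟨ cong (_+_ (sumOn f X)) vanishing ⟨
  sumOn f X + sumOn f (Y ─ X)    ≡⟨ sumOn-⊆-split f X⊆Y ⟨
  sumOn f Y                      ∎
  where
  open ≡-Reasoning
  vanishing : sumOn f (Y ─ X) ≡ 0ℤ
  vanishing = trans (sumOn-cong (Y ─ X) λ s∈Y─X → f≡0 (p─q⊆p Y X s∈Y─X) (∈─⇒∉ Y X s∈Y─X))
                    (sumOn-zeros (Y ─ X))

𝟙 : ∀ {A : Set} → Dec A → ℤ
𝟙 A? = if does A? then 1ℤ else 0ℤ

𝟙-yes : ∀ {A : Set} (A? : Dec A) → A → 𝟙 A? ≡ 1ℤ
𝟙-yes (yes _) _ = refl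
𝟙-yes (no ¬a) a = contradiction a ¬a

𝟙-no : ∀ {A : Set} (A? : Dec A) → ¬ A → 𝟙 A? ≡ 0ℤ
𝟙-no (yes a) ¬a = contradiction a ¬a
𝟙-no (no _) _ = refl

𝟙-nonneg : ∀ {A : Set} (A? : Dec A) → 0ℤ ≤ 𝟙 A?
𝟙-nonneg (yes _) = ℤP.<⇒≤ 0<1
𝟙-nonneg (no _) = ℤP.≤-refl

atLeast : ℤ → ℤ → ℤ
atLeast k a = 𝟙 (k ℤ.≤? a)

atLeast-≤ : ∀ {k a} → k ≤ a → atLeast k a ≡ 1ℤ
atLeast-≤ {k} {a} = 𝟙-yes (k ℤ.≤? a)

atLeast-< : ∀ {k a} → a < k → atLeast k a ≡ 0ℤ
atLeast-< {k} {a} a<k = 𝟙-no (k ℤ.≤? a) (ℤP.<⇒≱ a<k)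

count≥ : ℤ → List ℤ → ℤ
count≥ k [] = 0ℤ
count≥ k (a ∷ as) = atLeast k a + count≥ k as

count≥-↭ : ∀ k {xs ys} → xs ↭ ys → count≥ k xs ≡ count≥ k ys
count≥-↭ k ↭.refl = refl
count≥-↭ k (↭.prep x xs↭ys) = cong (_+_ (atLeast k x)) (count≥-↭ k xs↭ys)
count≥-↭ k (↭.swap {ys = ys} x y xs↭ys) =
  trans (cong (λ c → atLeast k x + (atLeast k y + c)) (count≥-↭ k xs↭ys))
        (x+[y+z]≡y+[x+z] (atLeast k x) (atLeast k y) (count≥ k ys))
count≥-↭ k (↭.trans xs↭ys ys↭zs) = trans (count≥-↭ k xs↭ys) (count≥-↭ k ys↭zs)

count≥-nonneg : ∀ k xs → 0ℤ ≤ count≥ k xs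
count≥-nonneg k [] = ℤP.≤-refl
count≥-nonneg k (a ∷ xs) = ℤP.+-mono-≤ (𝟙-nonneg (k ℤ.≤? a)) (count≥-nonneg k xs)

count≥-toList : ∀ {n} k (x : Fin n → ℤ) → count≥ k (toList x) ≡ sumOn (λ s → atLeast k (x s)) ⊤
count≥-toList {zero} k x = refl
count≥-toList {suc n} k x = cong (_+_ (atLeast k (x zero))) (count≥-toList k (x ∘ suc))

count≥-↓ : ∀ {n} k (x : Fin n → ℤ) → count≥ k (x ↓) ≡ sumOn (λ s → atLeast k (x s)) ⊤
count≥-↓ k x = begin
  count≥ k (reverse (sort (toList x)))  ≡⟨ count≥-↭ k (↭-reverse (sort (toList x))) ⟩
  count≥ k (sort (toList x))            ≡⟨ count≥-↭ k (sort-↭ (toList x)) ⟩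
  count≥ k (toList x)                   ≡⟨ count≥-toList k x ⟩
  sumOn (λ s → atLeast k (x s)) ⊤       ∎
  where open ≡-Reasoning

↓-length : ∀ {n} (x : Fin n → ℤ) → length (x ↓) ≡ n
↓-length x = begin
  length (reverse (sort (toList x)))  ≡⟨ ↭-length (↭-reverse (sort (toList x))) ⟩
  length (sort (toList x))            ≡⟨ ↭-length (sort-↭ (toList x)) ⟩
  length (toList x)                   ≡⟨ ListP.length-tabulate x ⟩
  _                                   ∎
  where open ≡-Reasoning

Descending : List ℤ → Set
Descending = AllPairs ℤ._≥_

reverse-descending : ∀ {xs} → AllPairs _≤_ xs → Descending (reverse xs)
reverse-descending {[]} [] = []
reverse-descending {x ∷ xs} (x≤xs ∷ xs↗) rewrite ListP.unfold-reverse x xs =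
  AllPairsP.++⁺ (reverse-descending xs↗) ([] ∷ [])
    (All.map (_∷ []) (All-resp-↭ (↭-sym (↭-reverse xs)) x≤xs))

↓-descending : ∀ {n} (x : Fin n → ℤ) → Descending (x ↓)
↓-descending x = reverse-descending (Linked⇒AllPairs ℤP.≤-trans (sort-↗ (toList x)))

count≥-head : ∀ x xs → 0ℤ < count≥ x (x ∷ xs)
count≥-head x xs = subst (λ c → 0ℤ < c + count≥ x xs) (sym (atLeast-≤ (ℤP.≤-refl {x})))
  (ℤP.<-≤-trans 0<1 (≤-+-nonneg 1ℤ (count≥-nonneg x xs)))

count≥-above-head : ∀ {y ys} k → Descending (y ∷ ys) → y < k → count≥ k (y ∷ ys) ≡ 0ℤ
count≥-above-head {y} {ys} k (y≥ys ∷ _) y<k =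
  below (y ∷ ys) (y<k ∷ All.map (λ z≤y → ℤP.≤-<-trans z≤y y<k) y≥ys)
  where
  below : ∀ zs → All (_< k) zs → count≥ k zs ≡ 0ℤ
  below [] [] = refl
  below (z ∷ zs) (z<k ∷ zs<k) = cong₂ _+_ (atLeast-< z<k) (below zs zs<k)

descending-≡ : ∀ {xs ys} → Descending xs → Descending ys →
  (∀ k → count≥ k xs ≡ count≥ k ys) → xs ≡ ys
descending-≡ {[]} {[]} _ _ counts = refl
descending-≡ {[]} {y ∷ ys} _ _ counts = contradiction (counts y) (ℤP.<⇒≢ (count≥-head y ys))
descending-≡ {x ∷ xs} {[]} _ _ counts = contradiction (sym (counts x)) (ℤP.<⇒≢ (count≥-head x xs))
descending-≡ {x ∷ xs} {y ∷ ys} x∷xs↓ y∷ys↓ counts with ℤP.<-cmp x y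
... | tri< x<y _ _ = contradiction (trans (sym (count≥-above-head y x∷xs↓ x<y)) (counts y))
                       (ℤP.<⇒≢ (count≥-head y ys))
... | tri> _ _ y<x = contradiction (sym (trans (counts x) (count≥-above-head x y∷ys↓ y<x)))
                       (ℤP.<⇒≢ (count≥-head x xs))
... | tri≈ _ refl _ = cong (x ∷_) (descending-≡ (AllPairs.tail x∷xs↓) (AllPairs.tail y∷ys↓)
        λ k → +-cancelˡ-≡ (atLeast k x) _ _ (counts k))

descending-lex : ∀ {xs ys} → Descending xs → Descending ys → length xs ≡ length ys → ∀ K →
  (∀ k → K < k → count≥ k xs ≡ count≥ k ys) → count≥ K xs < count≥ K ys → LexLt xs ys
descending-lex {[]} {[]} _ _ _ K _ lt = contradiction lt (ℤP.<-irrefl refl)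
descending-lex {x ∷ xs} {y ∷ ys} x∷xs↓ y∷ys↓ same-length K counts lt with ℤP.<-cmp x y
... | tri< x<y _ _ = here x<y
... | tri≈ _ refl _ = there (descending-lex (AllPairs.tail x∷xs↓) (AllPairs.tail y∷ys↓)
        (ℕP.suc-injective same-length) K (λ k K<k → +-cancelˡ-≡ (atLeast k x) _ _ (counts k K<k)) (+-cancelˡ-< (atLeast K x) lt))
... | tri> _ _ y<x with K ℤ.<? x
...   | yes K<x = contradiction (sym (trans (counts x K<x) (count≥-above-head x y∷ys↓ y<x)))
                  (ℤP.<⇒≢ (count≥-head x xs))
...   | no K≮x = contradiction
          (subst (count≥ K (x ∷ xs) <_) (count≥-above-head K y∷ys↓ (ℤP.<-≤-trans y<x (ℤP.≮⇒≥ K≮x))) lt)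
          (ℤP.≤⇒≯ (count≥-nonneg K (x ∷ xs)))

lex-irrefl : ∀ {xs} → ¬ LexLt xs xs
lex-irrefl (here x<x) = ℤP.<-irrefl refl x<x
lex-irrefl (there lt) = lex-irrefl lt

lex-asym : ∀ {xs ys} → LexLt xs ys → ¬ LexLt ys xs
lex-asym (here x<y) (here y<x) = ℤP.<-asym x<y y<x
lex-asym (here x<x) (there _) = ℤP.<-irrefl refl x<x
lex-asym (there _) (here x<x) = ℤP.<-irrefl refl x<x
lex-asym (there lt) (there gt) = lex-asym lt gt

lex-trans : ∀ {xs ys zs} → LexLt xs ys → LexLt ys zs → LexLt xs zs
lex-trans (here x<y) (here y<z) = here (ℤP.<-trans x<y y<z)
lex-trans (here x<y) (there _) = here x<y
lex-trans (there _) (here y<z) = here y<z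
lex-trans (there lt) (there lt′) = there (lex-trans lt lt′)

atLeast-below-band : ∀ {k β a} → k < β → β - 1ℤ ≤ a → atLeast k a ≡ 1ℤ
atLeast-below-band k<β β-1≤a = atLeast-≤ (ℤP.≤-trans (<⇒≤-1 k<β) β-1≤a)

atLeast-above-band : ∀ {k β a} → β < k → a ≤ β → atLeast k a ≡ 0ℤ
atLeast-above-band β<k a≤β = atLeast-< (ℤP.≤-<-trans a≤β β<k)

atLeast-top-of-band : ∀ {β a} → β - 1ℤ ≤ a → a ≤ β → atLeast β a ≡ a - (β - 1ℤ)
atLeast-top-of-band {β} {a} β-1≤a a≤β = by-cases (β ℤ.≤? a)
  where
  open ≡-Reasoning
  by-cases : Dec (β ≤ a) → atLeast β a ≡ a - (β - 1ℤ)
  by-cases (yes β≤a) = begin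
    atLeast β a      ≡⟨ atLeast-≤ β≤a ⟩
    1ℤ               ≡⟨ unit β ⟨
    β - (β - 1ℤ)     ≡⟨ cong (_- (β - 1ℤ)) (ℤP.≤-antisym β≤a a≤β) ⟩
    a - (β - 1ℤ)     ∎
    where
    unit : ∀ b → b - (b - 1ℤ) ≡ 1ℤ
    unit = solve-∀
  by-cases (no β≰a) = begin
    atLeast β a          ≡⟨ atLeast-< (ℤP.≰⇒> β≰a) ⟩
    0ℤ                   ≡⟨ ℤP.+-inverseʳ (β - 1ℤ) ⟨
    β - 1ℤ - (β - 1ℤ)    ≡⟨ cong (_- (β - 1ℤ)) (ℤP.≤-antisym β-1≤a (<⇒≤-1 (ℤP.≰⇒> β≰a))) ⟩
    a - (β - 1ℤ)         ∎

counts-on-band : ∀ {n} {S : Subset n} {β} {y z : Fin n → ℤ} →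
  (∀ {s} → s ∈ S → β - 1ℤ ≤ y s × y s ≤ β) → (∀ {s} → s ∈ S → β - 1ℤ ≤ z s × z s ≤ β) →
  sumOn y S ≡ sumOn z S → ∀ k → sumOn (λ s → atLeast k (y s)) S ≡ sumOn (λ s → atLeast k (z s)) S
counts-on-band {S = S} {β} {y} {z} y-band z-band sums k with ℤP.<-cmp k β
... | tri< k<β _ _ = trans (sumOn-cong S (atLeast-below-band k<β ∘ proj₁ ∘ y-band))
                     (sym (sumOn-cong S (atLeast-below-band k<β ∘ proj₁ ∘ z-band)))
... | tri> _ _ β<k = trans (sumOn-cong S (atLeast-above-band β<k ∘ proj₂ ∘ y-band))
                     (sym (sumOn-cong S (atLeast-above-band β<k ∘ proj₂ ∘ z-band)))
... | tri≈ _ refl _ = begin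
  sumOn (λ s → atLeast k (y s)) S   ≡⟨ sumOn-cong S (uncurry atLeast-top-of-band ∘ y-band) ⟩
  sumOn (λ s → y s - (k - 1ℤ)) S    ≡⟨ sumOn-minus-const y (k - 1ℤ) S ⟩
  sumOn y S - (k - 1ℤ) * + ∣ S ∣    ≡⟨ cong (_- (k - 1ℤ) * + ∣ S ∣) sums ⟩
  sumOn z S - (k - 1ℤ) * + ∣ S ∣    ≡⟨ sumOn-minus-const z (k - 1ℤ) S ⟨
  sumOn (λ s → z s - (k - 1ℤ)) S    ≡⟨ sumOn-cong S (uncurry atLeast-top-of-band ∘ z-band) ⟨
  sumOn (λ s → atLeast k (z s)) S   ∎
  where open ≡-Reasoning

⋂ˢ : ∀ {k n} → (Subset k → Subset n) → Subset n
⋂ˢ {zero} F = F []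
⋂ˢ {suc k} F = ⋂ˢ (F ∘ (inside ∷_)) ∩ ⋂ˢ (F ∘ (outside ∷_))

⋃ˢ : ∀ {k n} → (Subset k → Subset n) → Subset n
⋃ˢ {zero} F = F []
⋃ˢ {suc k} F = ⋃ˢ (F ∘ (inside ∷_)) ∪ ⋃ˢ (F ∘ (outside ∷_))

⋂ˢ-⊆ : ∀ {k n} (F : Subset k → Subset n) Z → ⋂ˢ F ⊆ F Z
⋂ˢ-⊆ F [] = λ s∈ → s∈
⋂ˢ-⊆ F (inside ∷ Z) = ⋂ˢ-⊆ (F ∘ (inside ∷_)) Z ∘ p∩q⊆p _ _
⋂ˢ-⊆ F (outside ∷ Z) = ⋂ˢ-⊆ (F ∘ (outside ∷_)) Z ∘ p∩q⊆q _ _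

⊆-⋃ˢ : ∀ {k n} (F : Subset k → Subset n) Z → F Z ⊆ ⋃ˢ F
⊆-⋃ˢ F [] = λ s∈ → s∈
⊆-⋃ˢ F (inside ∷ Z) = p⊆p∪q _ ∘ ⊆-⋃ˢ (F ∘ (inside ∷_)) Z
⊆-⋃ˢ F (outside ∷ Z) = q⊆p∪q _ _ ∘ ⊆-⋃ˢ (F ∘ (outside ∷_)) Z

⋂ˢ-closed : ∀ {k n} {P : Subset n → Set} → (∀ A B → P A → P B → P (A ∩ B)) →
  (F : Subset k → Subset n) → (∀ Z → P (F Z)) → P (⋂ˢ F)
⋂ˢ-closed {zero} P-∩ F P-F = P-F []
⋂ˢ-closed {suc k} P-∩ F P-F =
  P-∩ _ _ (⋂ˢ-closed P-∩ _ (P-F ∘ (inside ∷_))) (⋂ˢ-closed P-∩ _ (P-F ∘ (outside ∷_)))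

⋃ˢ-closed : ∀ {k n} {P : Subset n → Set} → (∀ A B → P A → P B → P (A ∪ B)) →
  (F : Subset k → Subset n) → (∀ Z → P (F Z)) → P (⋃ˢ F)
⋃ˢ-closed {zero} P-∪ F P-F = P-F []
⋃ˢ-closed {suc k} P-∪ F P-F =
  P-∪ _ _ (⋃ˢ-closed P-∪ _ (P-F ∘ (inside ∷_))) (⋃ˢ-closed P-∪ _ (P-F ∘ (outside ∷_)))

module Extremal {n} {P : Subset n → Set} (P? : Decidable P) where

  private
    orTop orBottom : Subset n → Subset n
    orTop Z = if does (P? Z) then Z else ⊤
    orBottom Z = if does (P? Z) then Z else ⊥

    orTop-chosen : ∀ {Z} → P Z → orTop Z ≡ Z
    orTop-chosen {Z} PZ with P? Z
    ... | yes _ = refl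
    ... | no ¬PZ = contradiction PZ ¬PZ

    orBottom-chosen : ∀ {Z} → P Z → orBottom Z ≡ Z
    orBottom-chosen {Z} PZ with P? Z
    ... | yes _ = refl
    ... | no ¬PZ = contradiction PZ ¬PZ

  least : Subset n
  least = ⋂ˢ orTop

  least-⊆ : ∀ {Z} → P Z → least ⊆ Z
  least-⊆ {Z} PZ = subst (least ⊆_) (orTop-chosen PZ) (⋂ˢ-⊆ orTop Z)

  least-sat : P ⊤ → (∀ A B → P A → P B → P (A ∩ B)) → P least
  least-sat P-⊤ P-∩ = ⋂ˢ-closed P-∩ orTop sat
    where
    sat : ∀ Z → P (orTop Z)
    sat Z with P? Z
    ... | yes PZ = PZ
    ... | no _ = P-⊤

  greatest : Subset n
  greatest = ⋃ˢ orBottom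

  ⊆-greatest : ∀ {Z} → P Z → Z ⊆ greatest
  ⊆-greatest {Z} PZ = subst (_⊆ greatest) (orBottom-chosen PZ) (⊆-⋃ˢ orBottom Z)

  greatest-sat : P ⊥ → (∀ A B → P A → P B → P (A ∪ B)) → P greatest
  greatest-sat P-⊥ P-∪ = ⋃ˢ-closed P-∪ orBottom sat
    where
    sat : ∀ Z → P (orBottom Z)
    sat Z with P? Z
    ... | yes PZ = PZ
    ... | no _ = P-⊥

-- Tight sets

fin-injective : ∀ {a b} → fin a ≡ fin b → a ≡ b
fin-injective refl = refl

fin≤fin⁻ : ∀ {a b} → fin a ≤∞ fin b → a ≤ b
fin≤fin⁻ (fin≤fin a≤b) = a≤b

_≟∞_ : (a b : ℤ∞) → Dec (a ≡ b)
-∞ ≟∞ -∞ = yes refl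
-∞ ≟∞ fin _ = no λ ()
fin _ ≟∞ -∞ = no λ ()
fin a ≟∞ fin b with a ℤ.≟ b
... | yes refl = yes refl
... | no a≢b = no (a≢b ∘ fin-injective)

≤∞-trans-≤ : ∀ {v a b} → v ≤∞ fin a → a ≤ b → v ≤∞ fin b
≤∞-trans-≤ -∞≤ _ = -∞≤
≤∞-trans-≤ (fin≤fin c≤a) a≤b = fin≤fin (ℤP.≤-trans c≤a a≤b)

Tight : ∀ {n} → (Subset n → ℤ∞) → (Fin n → ℤ) → Subset n → Set
Tight p y Z = p Z ≡ fin (sumOn y Z)

Separated : ∀ {n} → (Subset n → ℤ∞) → (Fin n → ℤ) → Fin n → Fin n → Set
Separated p y s t = ∃ λ Z → Tight p y Z × s ∈ Z × t ∉ Z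

tight? : ∀ {n} (p : Subset n → ℤ∞) (y : Fin n → ℤ) Z → Dec (Tight p y Z)
tight? p y Z = p Z ≟∞ fin (sumOn y Z)

separated? : ∀ {n} (p : Subset n → ℤ∞) (y : Fin n → ℤ) s t → Dec (Separated p y s t)
separated? p y s t = anySubset? λ Z → tight? p y Z ×-dec s ∈? Z ×-dec ¬? (t ∈? Z)

InB⇒≤∞ : ∀ {n} {p : Subset n → ℤ∞} {y} → InB p y → ∀ Z → p Z ≤∞ fin (sumOn y Z)
InB⇒≤∞ {p = p} {y} (tight-⊤ , above) Z with VecP.≡-dec BoolP._≟_ Z ⊤
... | yes refl = subst (_≤∞ fin (sumOn y ⊤)) (sym tight-⊤) (fin≤fin ℤP.≤-refl)
... | no Z≢⊤ = above Z Z≢⊤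

-- The paper's condition that y admits no 1-tightening step (see transfer-InB).
NoImprovingStep : ∀ {n} → (Subset n → ℤ∞) → (Fin n → ℤ) → Set
NoImprovingStep p y = ∀ s t → y t + 1ℤ < y s → Separated p y s t

module TightSets {n} {p : Subset n → ℤ∞} (p-sm : IsSupermodularFn p) {y : Fin n → ℤ} (y∈B : InB p y) where
  open IsSupermodularFn p-sm

  tight-⊥ : Tight p y ⊥
  tight-⊥ = trans p-empty (cong fin (sym (sumOn-⊥ y)))

  tight-⊤ : Tight p y ⊤
  tight-⊤ = proj₁ y∈B

  tight-∩-∪ : ∀ {A B} → Tight p y A → Tight p y B → Tight p y (A ∩ B) × Tight p y (A ∪ B)
  tight-∩-∪ {A} {B} tight-A tight-B with supermod A B _ _ tight-A tight-B
  ... | c , d , pA∩B , pA∪B , sums≤ =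
    trans pA∩B (cong fin (proj₁ squeezed)) , trans pA∪B (cong fin (proj₂ squeezed))
    where
    squeezed = squeeze
      (fin≤fin⁻ (subst (_≤∞ fin (sumOn y (A ∩ B))) pA∩B (InB⇒≤∞ y∈B (A ∩ B))))
      (fin≤fin⁻ (subst (_≤∞ fin (sumOn y (A ∪ B))) pA∪B (InB⇒≤∞ y∈B (A ∪ B))))
      (subst (_≤ c + d) (trans (sym (sumOn-∪-∩ y A B)) (ℤP.+-comm (sumOn y (A ∪ B)) _)) sums≤)

  tight-∩ : ∀ {A B} → Tight p y A → Tight p y B → Tight p y (A ∩ B)
  tight-∩ tight-A tight-B = proj₁ (tight-∩-∪ tight-A tight-B)

  tight-∪ : ∀ {A B} → Tight p y A → Tight p y B → Tight p y (A ∪ B)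
  tight-∪ tight-A tight-B = proj₂ (tight-∩-∪ tight-A tight-B)

  smallestTight : Fin n → Subset n
  smallestTight s = Extremal.least (λ Z → tight? p y Z ×-dec s ∈? Z)

  smallestTight-sat : ∀ s → Tight p y (smallestTight s) × s ∈ smallestTight s
  smallestTight-sat s = Extremal.least-sat (λ Z → tight? p y Z ×-dec s ∈? Z) (tight-⊤ , ∈⊤)
    λ _ _ (tight-A , s∈A) (tight-B , s∈B) → tight-∩ tight-A tight-B , x∈p∩q⁺ (s∈A , s∈B)

  smallestTight-⊆ : ∀ {s Z} → Tight p y Z → s ∈ Z → smallestTight s ⊆ Z
  smallestTight-⊆ {s} tight-Z s∈Z = Extremal.least-⊆ (λ Z → tight? p y Z ×-dec s ∈? Z) (tight-Z , s∈Z)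

  largestTightAvoiding : Fin n → Subset n
  largestTightAvoiding t = Extremal.greatest (λ Z → tight? p y Z ×-dec ¬? (t ∈? Z))

  largestTightAvoiding-sat : ∀ t → Tight p y (largestTightAvoiding t) × t ∉ largestTightAvoiding t
  largestTightAvoiding-sat t = Extremal.greatest-sat (λ Z → tight? p y Z ×-dec ¬? (t ∈? Z)) (tight-⊥ , ∉⊥)
    λ _ _ (tight-A , t∉A) (tight-B , t∉B) → tight-∪ tight-A tight-B , [ t∉A , t∉B ] ∘ x∈p∪q⁻ _ _

  ⊆-largestTightAvoiding : ∀ {t Z} → Tight p y Z → t ∉ Z → Z ⊆ largestTightAvoiding t
  ⊆-largestTightAvoiding {t} tight-Z t∉Z =
    Extremal.⊆-greatest (λ Z → tight? p y Z ×-dec ¬? (t ∈? Z)) (tight-Z , t∉Z)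

  module _ (no-step : NoImprovingStep p y) where

    smallestTight-gap : ∀ {s t} → t ∈ smallestTight s → y s ≤ y t + 1ℤ
    smallestTight-gap {s} {t} t∈ = ℤP.≮⇒≥ λ gap →
      let Z , tight-Z , s∈Z , t∉Z = no-step s t gap in t∉Z (smallestTight-⊆ tight-Z s∈Z t∈)

    ∈-largestTightAvoiding : ∀ {s t} → y t + 1ℤ < y s → s ∈ largestTightAvoiding t
    ∈-largestTightAvoiding {s} {t} gap =
      let Z , tight-Z , s∈Z , t∉Z = no-step s t gap in ⊆-largestTightAvoiding tight-Z t∉Z s∈Z

-- Unit transfers

χ : ∀ {n} → Fin n → Fin n → ℤ
χ zero zero = 1ℤ
χ zero (suc _) = 0ℤ
χ (suc _) zero = 0ℤ
χ (suc t) (suc u) = χ t u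

χ-self : ∀ {n} (t : Fin n) → χ t t ≡ 1ℤ
χ-self zero = refl
χ-self (suc t) = χ-self t

χ-other : ∀ {n} {t u : Fin n} → u ≢ t → χ t u ≡ 0ℤ
χ-other {t = zero} {zero} u≢t = contradiction refl u≢t
χ-other {t = zero} {suc u} _ = refl
χ-other {t = suc t} {zero} _ = refl
χ-other {t = suc t} {suc u} u≢t = χ-other (u≢t ∘ cong suc)

sumOn-χ-∈ : ∀ {n} {t : Fin n} {Z} → t ∈ Z → sumOn (χ t) Z ≡ 1ℤ
sumOn-χ-∈ {t = zero} {inside ∷ Z} here = cong (_+_ 1ℤ) (sumOn-zeros Z)
sumOn-χ-∈ {t = suc t} {inside ∷ Z} (there t∈Z) = trans (ℤP.+-identityˡ _) (sumOn-χ-∈ t∈Z)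
sumOn-χ-∈ {t = suc t} {outside ∷ Z} (there t∈Z) = sumOn-χ-∈ t∈Z

sumOn-χ-∉ : ∀ {n} {t : Fin n} {Z} → t ∉ Z → sumOn (χ t) Z ≡ 0ℤ
sumOn-χ-∉ {t = zero} {inside ∷ Z} t∉Z = contradiction here t∉Z
sumOn-χ-∉ {t = zero} {outside ∷ Z} _ = sumOn-zeros Z
sumOn-χ-∉ {t = suc t} {inside ∷ Z} t∉Z = trans (ℤP.+-identityˡ _) (sumOn-χ-∉ (t∉Z ∘ there))
sumOn-χ-∉ {t = suc t} {outside ∷ Z} t∉Z = sumOn-χ-∉ (t∉Z ∘ there)

sumOn-⊤-update₁ : ∀ {n} {f g : Fin n → ℤ} t → (∀ {u} → u ≢ t → f u ≡ g u) →
  sumOn f ⊤ + g t ≡ sumOn g ⊤ + f t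
sumOn-⊤-update₁ {f = f} {g} zero f≡g = begin
  f zero + sumOn (f ∘ suc) ⊤ + g zero
    ≡⟨ cong (λ r → f zero + r + g zero) (sumOn-cong ⊤ λ {u} _ → f≡g {suc u} λ ()) ⟩
  f zero + sumOn (g ∘ suc) ⊤ + g zero
    ≡⟨ exchange (f zero) (sumOn (g ∘ suc) ⊤) (g zero) ⟩
  g zero + sumOn (g ∘ suc) ⊤ + f zero  ∎
  where
  open ≡-Reasoning
  exchange : ∀ a b c → a + b + c ≡ c + b + a
  exchange = solve-∀
sumOn-⊤-update₁ {f = f} {g} (suc t) f≡g = begin
  f zero + sumOn (f ∘ suc) ⊤ + g (suc t)    ≡⟨ ℤP.+-assoc (f zero) _ _ ⟩
  f zero + (sumOn (f ∘ suc) ⊤ + g (suc t))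
    ≡⟨ cong₂ _+_ (f≡g λ ()) (sumOn-⊤-update₁ t λ u≢t → f≡g (u≢t ∘ FinP.suc-injective)) ⟩
  g zero + (sumOn (g ∘ suc) ⊤ + f (suc t))  ≡⟨ ℤP.+-assoc (g zero) _ _ ⟨
  g zero + sumOn (g ∘ suc) ⊤ + f (suc t)    ∎
  where open ≡-Reasoning

sumOn-⊤-update₂ : ∀ {n} {f g : Fin n → ℤ} s t → s ≢ t → (∀ {u} → u ≢ s → u ≢ t → f u ≡ g u) →
  sumOn f ⊤ + (g s + g t) ≡ sumOn g ⊤ + (f s + f t)
sumOn-⊤-update₂ zero zero s≢t _ = contradiction refl s≢t
sumOn-⊤-update₂ {f = f} {g} zero (suc t) _ f≡g = begin
  f zero + sumOn (f ∘ suc) ⊤ + (g zero + g (suc t))  ≡⟨ regroup (f zero) _ (g zero) _ ⟩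
  g zero + f zero + (sumOn (f ∘ suc) ⊤ + g (suc t))  ≡⟨ cong (_+_ (g zero + f zero)) tails ⟩
  g zero + f zero + (sumOn (g ∘ suc) ⊤ + f (suc t))  ≡⟨ interchange (g zero) _ (f zero) _ ⟨
  g zero + sumOn (g ∘ suc) ⊤ + (f zero + f (suc t))  ∎
  where
  open ≡-Reasoning
  regroup : ∀ a b c d → a + b + (c + d) ≡ c + a + (b + d)
  regroup = solve-∀
  interchange : ∀ a b c d → a + b + (c + d) ≡ a + c + (b + d)
  interchange = solve-∀
  tails : sumOn (f ∘ suc) ⊤ + g (suc t) ≡ sumOn (g ∘ suc) ⊤ + f (suc t)
  tails = sumOn-⊤-update₁ t λ u≢t → f≡g (λ ()) (u≢t ∘ FinP.suc-injective)
sumOn-⊤-update₂ {f = f} {g} (suc s) zero _ f≡g = begin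
  f zero + sumOn (f ∘ suc) ⊤ + (g (suc s) + g zero)  ≡⟨ regroup (f zero) _ _ (g zero) ⟩
  g zero + f zero + (sumOn (f ∘ suc) ⊤ + g (suc s))  ≡⟨ cong (_+_ (g zero + f zero)) tails ⟩
  g zero + f zero + (sumOn (g ∘ suc) ⊤ + f (suc s))  ≡⟨ regroup′ (g zero) _ _ (f zero) ⟨
  g zero + sumOn (g ∘ suc) ⊤ + (f (suc s) + f zero)  ∎
  where
  open ≡-Reasoning
  regroup : ∀ a b c d → a + b + (c + d) ≡ d + a + (b + c)
  regroup = solve-∀
  regroup′ : ∀ a b c d → a + b + (c + d) ≡ a + d + (b + c)
  regroup′ = solve-∀
  tails : sumOn (f ∘ suc) ⊤ + g (suc s) ≡ sumOn (g ∘ suc) ⊤ + f (suc s)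
  tails = sumOn-⊤-update₁ s λ u≢s → f≡g (u≢s ∘ FinP.suc-injective) (λ ())
sumOn-⊤-update₂ {f = f} {g} (suc s) (suc t) s≢t f≡g = begin
  f zero + sumOn (f ∘ suc) ⊤ + (g (suc s) + g (suc t))    ≡⟨ ℤP.+-assoc (f zero) _ _ ⟩
  f zero + (sumOn (f ∘ suc) ⊤ + (g (suc s) + g (suc t)))  ≡⟨ cong₂ _+_ (f≡g (λ ()) (λ ())) tails ⟩
  g zero + (sumOn (g ∘ suc) ⊤ + (f (suc s) + f (suc t)))  ≡⟨ ℤP.+-assoc (g zero) _ _ ⟨
  g zero + sumOn (g ∘ suc) ⊤ + (f (suc s) + f (suc t))    ∎
  where
  open ≡-Reasoning
  tails = sumOn-⊤-update₂ s t (s≢t ∘ cong suc)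
    λ u≢s u≢t → f≡g (u≢s ∘ FinP.suc-injective) (u≢t ∘ FinP.suc-injective)

sumSq : ∀ {n} → (Fin n → ℤ) → ℤ
sumSq y = sumOn (λ u → y u * y u) ⊤

sumSq-nonneg : ∀ {n} (y : Fin n → ℤ) → 0ℤ ≤ sumSq y
sumSq-nonneg y = sumOn-nonneg ⊤ λ {s} _ → square-nonneg (y s)
  where
  square-nonneg : ∀ a → 0ℤ ≤ a * a
  square-nonneg (+ zero) = ℤ.+≤+ ℕ.z≤n
  square-nonneg (+ suc _) = ℤ.+≤+ ℕ.z≤n
  square-nonneg ℤ.-[1+ _ ] = ℤ.+≤+ ℕ.z≤n

transfer : ∀ {n} → (Fin n → ℤ) → Fin n → Fin n → Fin n → ℤ
transfer y s t u = y u - χ s u + χ t u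

module _ {n} (y : Fin n → ℤ) {s t : Fin n} where

  transfer-source : s ≢ t → transfer y s t s ≡ y s - 1ℤ
  transfer-source s≢t = begin
    y s - χ s s + χ t s   ≡⟨ cong₂ (λ a b → y s - a + b) (χ-self s) (χ-other s≢t) ⟩
    y s - 1ℤ + 0ℤ         ≡⟨ ℤP.+-identityʳ _ ⟩
    y s - 1ℤ              ∎
    where open ≡-Reasoning

  transfer-target : s ≢ t → transfer y s t t ≡ y t + 1ℤ
  transfer-target s≢t = begin
    y t - χ s t + χ t t   ≡⟨ cong₂ (λ a b → y t - a + b) (χ-other (s≢t ∘ sym)) (χ-self t) ⟩
    y t - 0ℤ + 1ℤ         ≡⟨ cong (_+ 1ℤ) (ℤP.+-identityʳ (y t)) ⟩
    y t + 1ℤ              ∎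
    where open ≡-Reasoning

  transfer-elsewhere : ∀ {u} → u ≢ s → u ≢ t → transfer y s t u ≡ y u
  transfer-elsewhere {u} u≢s u≢t = begin
    y u - χ s u + χ t u   ≡⟨ cong₂ (λ a b → y u - a + b) (χ-other u≢s) (χ-other u≢t) ⟩
    y u - 0ℤ + 0ℤ         ≡⟨ trans (ℤP.+-identityʳ _) (ℤP.+-identityʳ (y u)) ⟩
    y u                   ∎
    where open ≡-Reasoning

  sumOn-transfer : ∀ Z → sumOn (transfer y s t) Z + sumOn (χ s) Z ≡ sumOn y Z + sumOn (χ t) Z
  sumOn-transfer Z = begin
    sumOn (transfer y s t) Z + sumOn (χ s) Z          ≡⟨ sumOn-+ (transfer y s t) (χ s) Z ⟨
    sumOn (λ u → transfer y s t u + χ s u) Z          ≡⟨ sumOn-cong Z (λ {u} _ → cancel (y u) (χ s u) (χ t u)) ⟩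
    sumOn (λ u → y u + χ t u) Z                       ≡⟨ sumOn-+ y (χ t) Z ⟩
    sumOn y Z + sumOn (χ t) Z                         ∎
    where
    open ≡-Reasoning
    cancel : ∀ a b c → a - b + c + b ≡ a + c
    cancel = solve-∀

  sumOn-∘transfer : s ≢ t → (F : ℤ → ℤ) →
    sumOn (λ u → F (transfer y s t u)) ⊤ + (F (y s) + F (y t)) ≡
    sumOn (λ u → F (y u)) ⊤ + (F (y s - 1ℤ) + F (y t + 1ℤ))
  sumOn-∘transfer s≢t F =
    trans (sumOn-⊤-update₂ s t s≢t λ u≢s u≢t → cong F (transfer-elsewhere u≢s u≢t))
          (cong (λ r → sumOn (λ u → F (y u)) ⊤ + r)
                (cong₂ _+_ (cong F (transfer-source s≢t)) (cong F (transfer-target s≢t))))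

  transfer-InB : ∀ {p : Subset n → ℤ∞} → InB p y → ¬ Separated p y s t → InB p (transfer y s t)
  transfer-InB {p} y∈B not-separated = total , above
    where
    y′ = transfer y s t
    total : p ⊤ ≡ fin (sumOn y′ ⊤)
    total = trans (proj₁ y∈B) (cong fin (sym (+-cancelʳ-≡ 1ℤ _ _ (begin
      sumOn y′ ⊤ + 1ℤ          ≡⟨ cong (_+_ (sumOn y′ ⊤)) (sumOn-χ-∈ {t = s} ∈⊤) ⟨
      sumOn y′ ⊤ + sumOn (χ s) ⊤ ≡⟨ sumOn-transfer ⊤ ⟩
      sumOn y ⊤ + sumOn (χ t) ⊤  ≡⟨ cong (_+_ (sumOn y ⊤)) (sumOn-χ-∈ {t = t} ∈⊤) ⟩
      sumOn y ⊤ + 1ℤ           ∎))))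
      where open ≡-Reasoning
    grow : ∀ {Z} → sumOn (χ s) Z ≤ sumOn (χ t) Z → p Z ≤∞ fin (sumOn y′ Z)
    grow {Z} χs≤χt = ≤∞-trans-≤ (InB⇒≤∞ y∈B Z) (balance-≤ (sym (sumOn-transfer Z)) χs≤χt)
    shrink : ∀ {Z} → s ∈ Z → t ∉ Z → p Z ≤∞ fin (sumOn y′ Z)
    shrink {Z} s∈Z t∉Z with p Z in pZ | InB⇒≤∞ y∈B Z
    ... | -∞ | _ = -∞≤
    ... | fin c | fin≤fin c≤y = fin≤fin (<+1⇒≤ (subst (c <_) y≡y′+1 (ℤP.≤∧≢⇒< c≤y not-tight)))
      where
      not-tight : c ≢ sumOn y Z
      not-tight c≡y = not-separated (Z , trans pZ (cong fin c≡y) , s∈Z , t∉Z)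
      y≡y′+1 : sumOn y Z ≡ sumOn y′ Z + 1ℤ
      y≡y′+1 = begin
        sumOn y Z                     ≡⟨ ℤP.+-identityʳ _ ⟨
        sumOn y Z + 0ℤ                ≡⟨ cong (_+_ (sumOn y Z)) (sumOn-χ-∉ t∉Z) ⟨
        sumOn y Z + sumOn (χ t) Z     ≡⟨ sumOn-transfer Z ⟨
        sumOn y′ Z + sumOn (χ s) Z    ≡⟨ cong (_+_ (sumOn y′ Z)) (sumOn-χ-∈ s∈Z) ⟩
        sumOn y′ Z + 1ℤ               ∎
        where open ≡-Reasoning
    above : ∀ Z → Z ≢ ⊤ → p Z ≤∞ fin (sumOn y′ Z)
    above Z _ with s ∈? Z | t ∈? Z
    ... | yes s∈Z | no t∉Z = shrink s∈Z t∉Z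
    ... | yes s∈Z | yes t∈Z = grow (ℤP.≤-reflexive (trans (sumOn-χ-∈ s∈Z) (sym (sumOn-χ-∈ t∈Z))))
    ... | no s∉Z | yes t∈Z = grow (subst₂ _≤_ (sym (sumOn-χ-∉ s∉Z)) (sym (sumOn-χ-∈ t∈Z)) (ℤP.<⇒≤ 0<1))
    ... | no s∉Z | no t∉Z = grow (ℤP.≤-reflexive (trans (sumOn-χ-∉ s∉Z) (sym (sumOn-χ-∉ t∉Z))))

  module _ (gap : y t + 1ℤ < y s) where

    private
      y′ = transfer y s t

      t<s : y t < y s
      t<s = ℤP.<-trans (<+1 (y t)) gap

      s≢t : s ≢ t
      s≢t refl = ℤP.<-asym gap (<+1 (y s))

    transfer-↓-lex : LexLt (y′ ↓) (y ↓)
    transfer-↓-lex = descending-lex (↓-descending y′) (↓-descending y) (trans (↓-length y′) (sym (↓-length y)))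
      (y s) counts-above count-at
      where
      counts : ∀ k {a b c d} → atLeast k (y s) ≡ a → atLeast k (y t) ≡ b →
        atLeast k (y s - 1ℤ) ≡ c → atLeast k (y t + 1ℤ) ≡ d →
        count≥ k (y′ ↓) + (a + b) ≡ count≥ k (y ↓) + (c + d)
      counts k refl refl refl refl = subst₂ (λ u v → u + _ ≡ v + _) (sym (count≥-↓ k y′)) (sym (count≥-↓ k y))
        (sumOn-∘transfer s≢t (atLeast k))
      counts-above : ∀ k → y s < k → count≥ k (y′ ↓) ≡ count≥ k (y ↓)
      counts-above k s<k = +-cancelʳ-≡ 0ℤ _ _ (counts k (atLeast-< s<k) (atLeast-< (ℤP.<-trans t<s s<k))
        (atLeast-< (ℤP.<-trans (-1< (y s)) s<k)) (atLeast-< (ℤP.<-trans gap s<k)))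
      count-at : count≥ (y s) (y′ ↓) < count≥ (y s) (y ↓)
      count-at = balance-< (counts (y s) (atLeast-≤ (ℤP.≤-refl {y s})) (atLeast-< t<s)
        (atLeast-< (-1< (y s))) (atLeast-< gap)) 0<1

    transfer-sumSq : sumSq y′ < sumSq y
    transfer-sumSq = balance-< (sumOn-∘transfer s≢t (λ a → a * a)) squares-drop
      where
      expand : ∀ a b →
        a * a + b * b ≡ (a - 1ℤ) * (a - 1ℤ) + (b + 1ℤ) * (b + 1ℤ) + ((a - (b + 1ℤ)) + (a - (b + 1ℤ)))
      expand = solve-∀
      squares-drop : (y s - 1ℤ) * (y s - 1ℤ) + (y t + 1ℤ) * (y t + 1ℤ) < y s * y s + y t * y t
      squares-drop = subst ((y s - 1ℤ) * (y s - 1ℤ) + (y t + 1ℤ) * (y t + 1ℤ) <_) (sym (expand (y s) (y t)))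
        (<-+-pos _ (ℤP.+-mono-< (<⇒0<- gap) (<⇒0<- gap)))

hfun-fin : ∀ {n} {p : Subset n → ℤ∞} {C d β X a} → p (X ∪ C) ≡ fin a →
  hfun p C d β X ≡ fin (a - d - (β - 1ℤ) * + ∣ X ∣)
hfun-fin pX∪C rewrite pX∪C = refl

hfun-fin⁻ : ∀ {n} {p : Subset n → ℤ∞} {C d β X v} → hfun p C d β X ≡ fin v →
  ∃ λ a → p (X ∪ C) ≡ fin a × v ≡ a - d - (β - 1ℤ) * + ∣ X ∣
hfun-fin⁻ {p = p} {C} {X = X} h≡v with p (X ∪ C)
hfun-fin⁻ refl | fin a = a , refl , refl

hfun-≤∞ : ∀ {n} {p : Subset n → ℤ∞} {C d β X v} →
  (∀ a → p (X ∪ C) ≡ fin a → a - d - (β - 1ℤ) * + ∣ X ∣ ≤ v) → hfun p C d β X ≤∞ fin v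
hfun-≤∞ {p = p} {C} {X = X} bound with p (X ∪ C) | bound
... | -∞ | _ = -∞≤
... | fin a | bound′ = fin≤fin (bound′ a refl)

∩∁-∪ : ∀ {n} (Z C : Subset n) → (Z ∩ ∁ C) ∪ C ≡ Z ∪ C
∩∁-∪ Z C = begin
  (Z ∩ ∁ C) ∪ C        ≡⟨ ∪-distribʳ-∩ C Z (∁ C) ⟩
  (Z ∪ C) ∩ (∁ C ∪ C)  ≡⟨ cong ((Z ∪ C) ∩_) (∪-inverseˡ C) ⟩
  (Z ∪ C) ∩ ⊤          ≡⟨ ∩-identityʳ (Z ∪ C) ⟩
  Z ∪ C                ∎
  where open ≡-Reasoning

⊆⇒∪≡ : ∀ {n} {C W : Subset n} → C ⊆ W → W ∪ C ≡ W
⊆⇒∪≡ {C = C} {W} C⊆W = ⊆-antisym ([ (λ s∈W → s∈W) , C⊆W ] ∘ x∈p∪q⁻ W C) (p⊆p∪q C)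

module CanonicalStepBounds {n} {p : Subset n → ℤ∞} (p-sm : IsSupermodularFn p)
    {y : Fin n → ℤ} (y∈B : InB p y) (no-step : NoImprovingStep p y)
    {C : Subset n} {β : ℤ} {Sj : Subset n} (step : CanonicalStep p C β Sj) (C-tight : Tight p y C) where

  open CanonicalStep step
  open TightSets p-sm y∈B

  d≡ : d ≡ sumOn y C
  d≡ = fin-injective (trans (sym p-C) C-tight)

  sumOn-outside : ∀ {X} → X ⊆ ∁ C → sumOn y (X ∪ C) - d ≡ sumOn y X
  sumOn-outside {X} X⊆∁C = begin
    sumOn y (X ∪ C) - d            ≡⟨ cong₂ _-_ (sumOn-∪-disjoint y X C (x∈∁p⇒x∉p ∘ X⊆∁C)) d≡ ⟩
    sumOn y X + sumOn y C - sumOn y C  ≡⟨ +-minus-cancel _ _ ⟩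
    sumOn y X                      ∎
    where open ≡-Reasoning

  -- If β < y s, every element of the smallest tight set containing s has value at least β (by
  -- smallestTight-gap), so its part X outside C would violate the bound y(X) ≤ β |X| defining β_j.
  ≤β-outside : ∀ {s} → s ∉ C → y s ≤ β
  ≤β-outside {s} s∉C = ℤP.≮⇒≥ λ β<ys → ℤP.<⇒≱ (above β<ys) below
    where
    X = smallestTight s ∩ ∁ C
    s∈X : s ∈ X
    s∈X = x∈p∩q⁺ (proj₂ (smallestTight-sat s) , x∉p⇒x∈∁p s∉C)
    X∪C-tight : Tight p y (X ∪ C)
    X∪C-tight = subst (Tight p y) (sym (∩∁-∪ (smallestTight s) C))
      (tight-∪ (proj₁ (smallestTight-sat s)) C-tight)
    below : sumOn y X ≤ sumOn (λ _ → β) X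
    below = subst₂ _≤_ (sumOn-outside (p∩q⊆q _ _)) (sym (sumOn-const β X))
      (⌈/⌉≤⇒≤* _ ∣ X ∣ β (ℕP.≤-<-trans ℕ.z≤n (x∈p⇒∣p-x∣<∣p∣ s∈X))
        (β-upper X (s , s∈X) (p∩q⊆q _ _) _ X∪C-tight))
    above : β < y s → sumOn (λ _ → β) X < sumOn y X
    above β<ys = sumOn-mono-< X
      (λ t∈X → <+1⇒≤ (ℤP.<-≤-trans β<ys (smallestTight-gap no-step (p∩q⊆p _ _ t∈X)))) s∈X β<ys

  ContainsTop : Subset n → Set
  ContainsTop Z = ∀ s → s ∉ C → y s ≡ β → s ∈ Z

  TightCover : Subset n → Set
  TightCover Z = Tight p y Z × C ⊆ Z × ContainsTop Z

  tightCover? : Decidable TightCover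
  tightCover? Z = tight? p y Z ×-dec C ⊆? Z ×-dec FinP.all? (λ s → ¬? (s ∈? C) →-dec (y s ℤ.≟ β →-dec s ∈? Z))

  W : Subset n
  W = Extremal.least tightCover?

  W-cover : TightCover W
  W-cover = Extremal.least-sat tightCover? (tight-⊤ , ⊆⊤ , λ _ _ _ → ∈⊤)
    λ _ _ (tight-A , C⊆A , top⊆A) (tight-B , C⊆B , top⊆B) →
      tight-∩ tight-A tight-B , (λ s∈C → x∈p∩q⁺ (C⊆A s∈C , C⊆B s∈C)) ,
      λ s s∉C ys≡β → x∈p∩q⁺ (top⊆A s s∉C ys≡β , top⊆B s s∉C ys≡β)

  W-⊆ : ∀ {Z} → TightCover Z → W ⊆ Z
  W-⊆ = Extremal.least-⊆ tightCover?

  -- If y t < β - 1, the largest tight set avoiding t contains C and every s ∉ C with y s = β,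
  -- hence contains W.
  β-1≤-on-W : ∀ {t} → t ∈ W → t ∉ C → β - 1ℤ ≤ y t
  β-1≤-on-W {t} t∈W t∉C = ℤP.≮⇒≥ λ yt<β-1 → proj₂ (largestTightAvoiding-sat t) (W-⊆ (covers yt<β-1) t∈W)
    where
    covers : y t < β - 1ℤ → TightCover (largestTightAvoiding t)
    covers yt<β-1 = proj₁ (largestTightAvoiding-sat t) , ⊆-largestTightAvoiding C-tight t∉C ,
      λ s _ ys≡β → ∈-largestTightAvoiding no-step (subst (y t + 1ℤ <_) (sym ys≡β) (<-1⇒+1< yt<β-1))

  isTop? : ∀ s → Dec (s ∉ C × y s ≡ β)
  isTop? s = ¬? (s ∈? C) ×-dec y s ℤ.≟ β

  atTop : Fin n → ℤ
  atTop s = 𝟙 (isTop? s)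

  excess : Fin n → ℤ
  excess s = y s - (β - 1ℤ)

  excess-at-top : ∀ {s} → s ∉ C → y s ≡ β → excess s ≡ atTop s
  excess-at-top {s} s∉C ys≡β = begin
    y s - (β - 1ℤ)  ≡⟨ cong (_- (β - 1ℤ)) ys≡β ⟩
    β - (β - 1ℤ)    ≡⟨ unit β ⟩
    1ℤ              ≡⟨ 𝟙-yes (isTop? s) (s∉C , ys≡β) ⟨
    atTop s         ∎
    where
    open ≡-Reasoning
    unit : ∀ b → b - (b - 1ℤ) ≡ 1ℤ
    unit = solve-∀

  atTop-off : ∀ {s} → y s ≢ β → atTop s ≡ 0ℤ
  atTop-off {s} ys≢β = 𝟙-no (isTop? s) (ys≢β ∘ proj₂)

  excess≤atTop : ∀ {s} → s ∉ C → excess s ≤ atTop s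
  excess≤atTop {s} s∉C = by-level (y s ℤ.≟ β)
    where
    by-level : Dec (y s ≡ β) → excess s ≤ atTop s
    by-level (yes ys≡β) = ℤP.≤-reflexive (excess-at-top s∉C ys≡β)
    by-level (no ys≢β) = subst (excess s ≤_) (sym (atTop-off ys≢β))
      (ℤP.i≤j⇒i-j≤0 (<⇒≤-1 (ℤP.≤∧≢⇒< (≤β-outside s∉C) ys≢β)))

  excess≡atTop : ∀ {s} → s ∉ C → β - 1ℤ ≤ y s → excess s ≡ atTop s
  excess≡atTop {s} s∉C β-1≤ys = by-level (y s ℤ.≟ β)
    where
    by-level : Dec (y s ≡ β) → excess s ≡ atTop s
    by-level (yes ys≡β) = excess-at-top s∉C ys≡β
    by-level (no ys≢β) = begin
      y s - (β - 1ℤ)         ≡⟨ cong (_- (β - 1ℤ)) ys≡β-1 ⟩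
      β - 1ℤ - (β - 1ℤ)      ≡⟨ ℤP.+-inverseʳ (β - 1ℤ) ⟩
      0ℤ                     ≡⟨ atTop-off ys≢β ⟨
      atTop s                  ∎
      where
      open ≡-Reasoning
      ys≡β-1 : y s ≡ β - 1ℤ
      ys≡β-1 = ℤP.≤-antisym (<⇒≤-1 (ℤP.≤∧≢⇒< (≤β-outside s∉C) ys≢β)) β-1≤ys

  -- N, the number of s ∉ C with y s = β, is the maximum of h_j; it is attained at W ∖ C.
  N : ℤ
  N = sumOn atTop (∁ C)

  sumOn-excess : ∀ {X} → X ⊆ ∁ C → sumOn excess X ≡ sumOn y (X ∪ C) - d - (β - 1ℤ) * + ∣ X ∣
  sumOn-excess {X} X⊆∁C = trans (sumOn-minus-const y (β - 1ℤ) X)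
    (cong (_- (β - 1ℤ) * + ∣ X ∣) (sym (sumOn-outside X⊆∁C)))

  module _ {X a} (X⊆∁C : X ⊆ ∁ C) (pX∪C : p (X ∪ C) ≡ fin a) where

    private
      h = a - d - (β - 1ℤ) * + ∣ X ∣

      h≤excess : h ≤ sumOn excess X
      h≤excess = subst (h ≤_) (sym (sumOn-excess X⊆∁C))
        (ℤP.+-monoˡ-≤ _ (ℤP.+-monoˡ-≤ _ (fin≤fin⁻ (subst (_≤∞ _) pX∪C (InB⇒≤∞ y∈B (X ∪ C))))))

      excess≤atTopX : sumOn excess X ≤ sumOn atTop X
      excess≤atTopX = sumOn-mono-≤ X (excess≤atTop ∘ x∈∁p⇒x∉p ∘ X⊆∁C)

      atTopX≤N : sumOn atTop X ≤ N
      atTopX≤N = sumOn-⊆-≤ X⊆∁C λ {s} _ → 𝟙-nonneg (isTop? s)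

    h≤N : h ≤ N
    h≤N = ℤP.≤-trans h≤excess (ℤP.≤-trans excess≤atTopX atTopX≤N)

    N≤h⇒tight×top : N ≤ h → Tight p y (X ∪ C) × ContainsTop X
    N≤h⇒tight×top N≤h = tight , at-top
      where
      h≡excess : h ≡ sumOn y (X ∪ C) - d - (β - 1ℤ) * + ∣ X ∣
      h≡excess = ℤP.≤-antisym (subst (h ≤_) (sumOn-excess X⊆∁C) h≤excess)
        (ℤP.≤-trans (subst (_≤ N) (sumOn-excess X⊆∁C) (ℤP.≤-trans excess≤atTopX atTopX≤N)) N≤h)
      tight : Tight p y (X ∪ C)
      tight = trans pX∪C (cong fin (+-cancelʳ-≡ (- d) _ _ (+-cancelʳ-≡ _ _ _ h≡excess)))
      at-top : ContainsTop X
      at-top s s∉C ys≡β with s ∈? X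
      ... | yes s∈X = s∈X
      ... | no s∉X = contradiction
        (ℤP.≤-trans N≤h (ℤP.≤-trans h≤excess excess≤atTopX))
        (ℤP.<⇒≱ (sumOn-⊆-< X⊆∁C (λ {u} _ → 𝟙-nonneg (isTop? u)) (x∉p⇒x∈∁p s∉C) s∉X
          (subst (0ℤ <_) (sym (𝟙-yes (isTop? s) (s∉C , ys≡β))) 0<1)))

  X₀ : Subset n
  X₀ = W ∩ ∁ C

  X₀-⊆ : X₀ ⊆ ∁ C
  X₀-⊆ = p∩q⊆q W (∁ C)

  X₀∪C≡W : X₀ ∪ C ≡ W
  X₀∪C≡W = trans (∩∁-∪ W C) (⊆⇒∪≡ (proj₁ (proj₂ W-cover)))

  h-X₀ : hfun p C d β X₀ ≡ fin N
  h-X₀ = trans (hfun-fin {p = p} {C} (subst (Tight p y) (sym X₀∪C≡W) (proj₁ W-cover)))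
    (cong fin (begin
      sumOn y (X₀ ∪ C) - d - (β - 1ℤ) * + ∣ X₀ ∣  ≡⟨ sumOn-excess X₀-⊆ ⟨
      sumOn excess X₀                             ≡⟨ sumOn-cong X₀ excess≡atTop-on-X₀ ⟩
      sumOn atTop X₀                              ≡⟨ sumOn-⊆-≡ X₀-⊆ atTop-outside-X₀ ⟩
      N                                           ∎))
    where
    open ≡-Reasoning
    excess≡atTop-on-X₀ : ∀ {s} → s ∈ X₀ → excess s ≡ atTop s
    excess≡atTop-on-X₀ s∈X₀ = let s∈W , s∈∁C = x∈p∩q⁻ W (∁ C) s∈X₀ in
      excess≡atTop (x∈∁p⇒x∉p s∈∁C) (β-1≤-on-W s∈W (x∈∁p⇒x∉p s∈∁C))
    atTop-outside-X₀ : ∀ {s} → s ∈ ∁ C → s ∉ X₀ → atTop s ≡ 0ℤ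
    atTop-outside-X₀ {s} s∈∁C s∉X₀ =
      atTop-off λ ys≡β → s∉X₀ (x∈p∩q⁺ (proj₂ (proj₂ W-cover) s (x∈∁p⇒x∉p s∈∁C) ys≡β , s∈∁C))

  X₀-maximizer : IsMaximizer p C d β X₀
  X₀-maximizer = X₀-⊆ , N , h-X₀ , λ Y Y⊆∁C → hfun-≤∞ {p = p} {C} (λ a pY∪C → h≤N Y⊆∁C pY∪C)

  -- X₀ maximizes h_j, and every maximizer X satisfies W ⊆ X ∪ C, so X₀ is the intersection of all of them.
  Sj≡X₀ : Sj ≡ X₀
  Sj≡X₀ = ⊆-antisym (λ {s} s∈Sj → Equivalence.to (Sj-def s) s∈Sj X₀ X₀-maximizer)
    λ {s} s∈X₀ → Equivalence.from (Sj-def s) λ X (X⊆∁C , v , hX≡v , X-max) →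
      let a , pX∪C , v≡h = hfun-fin⁻ {p = p} {C} hX≡v
          N≤v = fin≤fin⁻ (subst (_≤∞ fin v) h-X₀ (X-max X₀ X₀-⊆))
          X∪C-tight , X-top = N≤h⇒tight×top X⊆∁C pX∪C (subst (N ≤_) v≡h N≤v)
          W⊆X∪C = W-⊆ (X∪C-tight , q⊆p∪q X C , λ s s∉C ys≡β → p⊆p∪q C (X-top s s∉C ys≡β))
          s∈W , s∈∁C = x∈p∩q⁻ W (∁ C) s∈X₀
      in [ (λ s∈X → s∈X) , (λ s∈C → contradiction s∈C (x∈∁p⇒x∉p s∈∁C)) ] (x∈p∪q⁻ X C (W⊆X∪C s∈W))

  part-outside : ∀ {s} → s ∈ Sj → s ∉ C
  part-outside s∈Sj = x∈∁p⇒x∉p (X₀-⊆ (subst (_ ∈_) Sj≡X₀ s∈Sj))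

  part-bounds : ∀ {s} → s ∈ Sj → β - 1ℤ ≤ y s × y s ≤ β
  part-bounds s∈Sj = β-1≤-on-W (p∩q⊆p W (∁ C) (subst (_ ∈_) Sj≡X₀ s∈Sj)) (part-outside s∈Sj) ,
                     ≤β-outside (part-outside s∈Sj)

  C∪Sj-tight : Tight p y (C ∪ Sj)
  C∪Sj-tight = subst (Tight p y) (sym C∪Sj≡W) (proj₁ W-cover)
    where
    C∪Sj≡W : C ∪ Sj ≡ W
    C∪Sj≡W = trans (cong (C ∪_) Sj≡X₀) (trans (∪-comm C X₀) X₀∪C≡W)

-- The canonical chain

CanonicallyBounded : ∀ {n} → (Subset n → ℤ∞) → ∀ {q} → (Fin q → ℤ) → (Fin (suc q) → Subset n) →
  (Fin q → Subset n) → (Fin n → ℤ) → Set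
CanonicallyBounded p {q} β C Sp y =
  (∀ (i : Fin q) → Tight p y (C (suc i))) × (∀ (i : Fin q) s → s ∈ Sp i → β i - 1ℤ ≤ y s × y s ≤ β i)

module CanonicalChainBounds {n} {p : Subset n → ℤ∞} (p-sm : IsSupermodularFn p)
    {y : Fin n → ℤ} (y∈B : InB p y) (no-step : NoImprovingStep p y)
    {q β C Sp} (canon : IsCanonical p q β C Sp) where

  open IsCanonical canon
  open TightSets p-sm y∈B

  chain-tight : ∀ i → Tight p y (C i)
  chain-tight = <-weakInduction (Tight p y ∘ C) (subst (Tight p y) (sym C-zero) tight-⊥)
    λ j C-tight → subst (Tight p y) (sym (C-next j))
      (CanonicalStepBounds.C∪Sj-tight p-sm y∈B no-step (step j) C-tight)

  private
    module Step j = CanonicalStepBounds p-sm y∈B no-step (step j) (chain-tight (inject₁ j))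

  canonicallyBounded : CanonicallyBounded p β C Sp y
  canonicallyBounded = chain-tight ∘ suc , λ i s → Step.part-bounds i

  part-outside : ∀ i {s} → s ∈ Sp i → s ∉ C (inject₁ i)
  part-outside = Step.part-outside

canonicallyBounded⇒↓≡ : ∀ {n} {p : Subset n → ℤ∞} → IsSupermodularFn p → ∀ {q β C Sp} →
  IsCanonical p q β C Sp → (∀ i {s} → s ∈ Sp i → s ∉ C (inject₁ i)) → ∀ {y z} →
  CanonicallyBounded p β C Sp y → CanonicallyBounded p β C Sp z → y ↓ ≡ z ↓
canonicallyBounded⇒↓≡ {n} {p} p-sm {q} {β} {C} {Sp} canon part-outside {y} {z}
  (y-tight , y-band) (z-tight , z-band) =
  descending-≡ (↓-descending y) (↓-descending z) λ k → begin
    count≥ k (y ↓)                               ≡⟨ count≥-↓ k y ⟩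
    sumOn (λ s → atLeast k (y s)) ⊤              ≡⟨ cong (sumOn _) C-last ⟨
    sumOn (λ s → atLeast k (y s)) (C (fromℕ q))  ≡⟨ chain-counts k (fromℕ q) ⟩
    sumOn (λ s → atLeast k (z s)) (C (fromℕ q))  ≡⟨ cong (sumOn _) C-last ⟩
    sumOn (λ s → atLeast k (z s)) ⊤              ≡⟨ count≥-↓ k z ⟨
    count≥ k (z ↓)                               ∎
  where
  open ≡-Reasoning
  open IsCanonical canon
  open IsSupermodularFn p-sm using (p-empty)
  split : ∀ f j → sumOn f (C (suc j)) ≡ sumOn f (C (inject₁ j)) + sumOn f (Sp j)
  split f j = trans (cong (sumOn f) (C-next j)) (sumOn-∪-disjoint f _ _ λ s∈C s∈Sp → part-outside j s∈Sp s∈C)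
  from-zero : ∀ f g → sumOn f (C zero) ≡ sumOn g (C zero)
  from-zero f g = trans (cong (sumOn f) C-zero)
    (trans (sumOn-⊥ f) (sym (trans (cong (sumOn g) C-zero) (sumOn-⊥ g))))
  chain-sums : ∀ i → sumOn y (C i) ≡ sumOn z (C i)
  chain-sums zero = from-zero y z
  chain-sums (suc j) = fin-injective (trans (sym (y-tight j)) (z-tight j))
  part-sums : ∀ j → sumOn y (Sp j) ≡ sumOn z (Sp j)
  part-sums j = +-cancelˡ-≡ (sumOn y (C (inject₁ j))) _ _ (begin
    sumOn y (C (inject₁ j)) + sumOn y (Sp j)  ≡⟨ split y j ⟨
    sumOn y (C (suc j))                       ≡⟨ chain-sums (suc j) ⟩
    sumOn z (C (suc j))                       ≡⟨ split z j ⟩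
    sumOn z (C (inject₁ j)) + sumOn z (Sp j)  ≡⟨ cong (_+ sumOn z (Sp j)) (chain-sums (inject₁ j)) ⟨
    sumOn y (C (inject₁ j)) + sumOn z (Sp j)  ∎)
  chain-counts : ∀ k i → sumOn (λ s → atLeast k (y s)) (C i) ≡ sumOn (λ s → atLeast k (z s)) (C i)
  chain-counts k = <-weakInduction _ (from-zero _ _) λ j counts-j → begin
    sumOn ky (C (suc j))
      ≡⟨ split ky j ⟩
    sumOn ky (C (inject₁ j)) + sumOn ky (Sp j)
      ≡⟨ cong₂ _+_ counts-j (counts-on-band (y-band j _) (z-band j _) (part-sums j) k) ⟩
    sumOn kz (C (inject₁ j)) + sumOn kz (Sp j)
      ≡⟨ split kz j ⟨
    sumOn kz (C (suc j))  ∎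
    where
    ky kz : Fin n → ℤ
    ky s = atLeast k (y s)
    kz s = atLeast k (z s)

improvingStep? : ∀ {n} (p : Subset n → ℤ∞) (y : Fin n → ℤ) →
  (∃₂ λ s t → y t + 1ℤ < y s × ¬ Separated p y s t) ⊎ NoImprovingStep p y
improvingStep? p y
  with FinP.any? (λ s → FinP.any? (λ t → y t + 1ℤ ℤ.<? y s ×-dec ¬? (separated? p y s t)))
... | yes (s , t , gap , not-separated) = inj₁ (s , t , gap , not-separated)
... | no none = inj₂ λ s t gap →
  decidable-stable (separated? p y s t) λ not-separated → none (s , t , gap , not-separated)

decMin⇒noImprovingStep : ∀ {n} {p : Subset n → ℤ∞} {m} → DecMin p m → NoImprovingStep p m
decMin⇒noImprovingStep {p = p} {m} (m∈B , minimal) s t gap with separated? p m s t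
... | yes separated = separated
... | no not-separated with minimal (transfer m s t) (transfer-InB m m∈B not-separated)
...   | inj₁ m↓≡ = contradiction (subst (λ l → LexLt l (m ↓)) (sym m↓≡) (transfer-↓-lex m gap)) lex-irrefl
...   | inj₂ m<  = contradiction (transfer-↓-lex m gap) (lex-asym m<)

-- Descend from y along improving transfers (Σ y² drops each time) to an element without one,
-- whose decreasing rearrangement equals that of m.
canonicallyBounded⇒lex-minimal : ∀ {n} {p : Subset n → ℤ∞} → IsSupermodularFn p → ∀ {q β C Sp} →
  IsCanonical p q β C Sp → ∀ {m} → CanonicallyBounded p β C Sp m →
  ∀ y → InB p y → (m ↓ ≡ y ↓) ⊎ LexLt (m ↓) (y ↓)
canonicallyBounded⇒lex-minimal {p = p} p-sm canon {m} m-bounded y = go y (<-wellFounded ℤ.∣ sumSq y ∣)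
  where
  go : ∀ y → Acc ℕ._<_ ℤ.∣ sumSq y ∣ → InB p y → (m ↓ ≡ y ↓) ⊎ LexLt (m ↓) (y ↓)
  go y (acc smaller) y∈B with improvingStep? p y
  ... | inj₂ no-step = inj₁ (canonicallyBounded⇒↓≡ p-sm canon part-outside m-bounded canonicallyBounded)
    where open CanonicalChainBounds p-sm y∈B no-step canon
  ... | inj₁ (s , t , gap , not-separated)
    with go (transfer y s t) (smaller (∣∣-mono-< (sumSq-nonneg (transfer y s t)) (transfer-sumSq y gap)))
            (transfer-InB y y∈B not-separated)
  ...   | inj₁ m↓≡ = inj₂ (subst (λ l → LexLt l (y ↓)) (sym m↓≡) (transfer-↓-lex y gap))
  ...   | inj₂ m<  = inj₂ (lex-trans m< (transfer-↓-lex y gap))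

corollary5p4 : (n : ℕ) → 0 ℕ.< n → (p : Subset n → ℤ∞) → IsSupermodularFn p →
    (q : ℕ) (β : Fin q → ℤ) (C : Fin (suc q) → Subset n) (Sp : Fin q → Subset n) →
    IsCanonical p q β C Sp →
    (m : Fin n → ℤ) → InB p m →
    DecMin p m ⇔
      ((∀ (i : Fin q) → p (C (suc i)) ≡ fin (sumOn m (C (suc i)))) ×
       (∀ (i : Fin q) (s : Fin n) → s ∈ Sp i → (β i - + 1 ≤ m s) × (m s ≤ β i)))
corollary5p4 n _ p p-sm q β C Sp canon m m∈B = mk⇔
  (λ m-min → CanonicalChainBounds.canonicallyBounded p-sm m∈B (decMin⇒noImprovingStep m-min) canon)
  (λ m-bounded → m∈B , canonicallyBounded⇒lex-minimal p-sm canon m-bounded)
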